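{- Let $\Gamma,\Delta$ be multisets of positive formulas, $A,B,A',B'$ positive formulas and $p$ a propositional variable, over some set of positive extension axioms including all extension variables occurring in $A$ and $B$ (and the other formulas). There is a $\mathsf{posELNDT}$ derivation of $\Gamma,\mathrm{pd}(A,p,B)\to\Delta,\mathrm{pd}(A',p,B')$ from the hypotheses $\Gamma,A\to\Delta,A'$ and $\Gamma,B\to\Delta,B'$ (and those extension axioms), of size polynomial in the sizes of the sequents involved and of the extension axioms.
   Context: eNDT formulas: built from propositional variables, constants $0,1$ and extension variables by $\vee$ and decisions $\mathrm{dec}(A,p,B)$ ("if $p$ then $B$ else $A$", $p$ a propositional variable). $\mathrm{pd}(A,p,C):=\mathrm{dec}(A,p,A\vee C)$; positive formulas have only decisions of this form. Extension axioms form a well-founded system $\{e_i\leftrightarrow A_i\}$ (each $A_i$ uses only earlier extension variables), positive if each $A_i$ is positive; $e\leftrightarrow A$ stands for sequents $e\to A$ and $A\to e$. $\mathsf{posELNDT}$: sequents on multisets; initial sequents $0\to$, $\to1$, $p\to p$; cut; left/right weakening and contraction; $\vee$-left (from $\Gamma,A\to\Delta$ and $\Gamma,B\to\Delta$ infer $\Gamma,A\vee B\to\Delta$); $\vee$-right (from $\Gamma\to\Delta,A,B$ infer $\Gamma\to\Delta,A\vee B$); positive decision left (from $\Gamma,A\to\Delta$ and $\Gamma,p,B\to\Delta$ infer $\Gamma,\mathrm{pd}(A,p,B)\to\Delta$) and right (from $\Gamma\to\Delta,A,p$ and $\Gamma\to\Delta,A,B$ infer $\Gamma\to\Delta,\mathrm{pd}(A,p,B)$);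 all formulas positive. A derivation from hypotheses is a finite list of sequents each a hypothesis, an extension axiom sequent, or following from earlier ones by a rule. Size = number of symbols. -}

module Defs where

open import Data.Nat using (ℕ; zero; suc; _+_; _*_; _^_; _≤_; _<_)
open import Data.Fin using (Fin; toℕ)
open import Data.List using (List; []; _∷_; _++_; [_]; length; lookup; map)
open import Data.Nat.ListAction using (sum)
open import Data.List.Relation.Unary.All using (All)
open import Data.List.Relation.Unary.Any using (Any)
open import Data.List.Relation.Binary.Permutation.Propositional using (_↭_)
open import Data.Product using (_×_; _,_; Σ; ∃; proj₁; proj₂)
open import Relation.Binary.PropositionalEquality using (_≡_)

-- Propositional variables and extension variables are
-- both named by natural numbers; extension variable  ext i  is the one
-- defined by the i-th entry of an extension system (see below).

data Fm : Set where
  var  : ℕ → Fm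
  ext  : ℕ → Fm
  𝟘 𝟙  : Fm
  _∨f_ : Fm → Fm → Fm
  dec  : Fm → ℕ → Fm → Fm       -- dec(A,p,B): if p then B else A

pd : Fm → ℕ → Fm → Fm
pd A p C = dec A p (A ∨f C)

data Positive : Fm → Set where
  pos-var : ∀ p → Positive (var p)
  pos-ext : ∀ i → Positive (ext i)
  pos-0   : Positive 𝟘
  pos-1   : Positive 𝟙
  pos-∨   : ∀ {A B} → Positive A → Positive B → Positive (A ∨f B)
  pos-pd  : ∀ {A C} p → Positive A → Positive C → Positive (pd A p C)

data Below (n : ℕ) : Fm → Set where
  b-var : ∀ p → Below n (var p)
  b-ext : ∀ {i} → i < n → Below n (ext i)
  b-0   : Below n 𝟘
  b-1   : Below n 𝟙
  b-∨   : ∀ {A B} → Below n A → Below n B → Below n (A ∨f B)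
  b-dec : ∀ {A B} p → Below n A → Below n B → Below n (dec A p B)

-- Extension systems {e_i ↔ A_i}: entry i of the list is A_i.

ExtSys : Set
ExtSys = List Fm

WellFounded : ExtSys → Set
WellFounded E = (i : Fin (length E)) → Below (toℕ i) (lookup E i)

PositiveSys : ExtSys → Set
PositiveSys E = All Positive E

-- Sequents  Γ → Δ  (cedents are multisets, represented by lists and
-- compared up to permutation).

Seq : Set
Seq = List Fm × List Fm

infix 4 _≈S_
_≈S_ : Seq → Seq → Set
(Γ , Δ) ≈S (Γ' , Δ') = (Γ ↭ Γ') × (Δ ↭ Δ')

data ExtAxiom (E : ExtSys) : Seq → Set where
  ext-l : (i : Fin (length E)) → ExtAxiom E ([ ext (toℕ i) ] , [ lookup E i ])
  ext-r : (i : Fin (length E)) → ExtAxiom E ([ lookup E i ] , [ ext (toℕ i) ])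

data Initial : Seq → Set where
  init-0 : Initial ([ 𝟘 ] , [])
  init-1 : Initial ([] , [ 𝟙 ])
  init-p : ∀ p → Initial ([ var p ] , [ var p ])

data Rule : List Seq → Seq → Set where
  cut   : ∀ Γ Δ A → Rule ((Γ , Δ ++ [ A ]) ∷ (Γ ++ [ A ] , Δ) ∷ []) (Γ , Δ)
  wk-l  : ∀ Γ Δ A → Rule ((Γ , Δ) ∷ []) (Γ ++ [ A ] , Δ)
  wk-r  : ∀ Γ Δ A → Rule ((Γ , Δ) ∷ []) (Γ , Δ ++ [ A ])
  ctr-l : ∀ Γ Δ A → Rule ((Γ ++ A ∷ A ∷ [] , Δ) ∷ []) (Γ ++ [ A ] , Δ)
  ctr-r : ∀ Γ Δ A → Rule ((Γ , Δ ++ A ∷ A ∷ []) ∷ []) (Γ , Δ ++ [ A ])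
  ∨-l   : ∀ Γ Δ A B →
          Rule ((Γ ++ [ A ] , Δ) ∷ (Γ ++ [ B ] , Δ) ∷ []) (Γ ++ [ A ∨f B ] , Δ)
  ∨-r   : ∀ Γ Δ A B →
          Rule ((Γ , Δ ++ A ∷ B ∷ []) ∷ []) (Γ , Δ ++ [ A ∨f B ])
  pd-l  : ∀ Γ Δ A p B →
          Rule ((Γ ++ [ A ] , Δ) ∷ (Γ ++ var p ∷ B ∷ [] , Δ) ∷ []) (Γ ++ [ pd A p B ] , Δ)
  pd-r  : ∀ Γ Δ A p B →
          Rule ((Γ , Δ ++ A ∷ var p ∷ []) ∷ (Γ , Δ ++ A ∷ B ∷ []) ∷ []) (Γ , Δ ++ [ pd A p B ])

data Justified (H : List Seq) (E : ExtSys) (earlier : List Seq) (S : Seq) : Set where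
  by-hyp  : Any (λ T → S ≈S T) H → Justified H E earlier S
  by-ext  : ∀ {T} → ExtAxiom E T → S ≈S T → Justified H E earlier S
  by-init : ∀ {T} → Initial T → S ≈S T → Justified H E earlier S
  by-rule : ∀ {prems T} → Rule prems T → S ≈S T →
            All (λ P → Any (λ Q → Q ≈S P) earlier) prems → Justified H E earlier S

GoodSeq : ExtSys → Seq → Set
GoodSeq E (Γ , Δ) = All (λ F → Positive F × Below (length E) F) (Γ ++ Δ)

-- A derivation is a list of lines, stored in REVERSE order
-- (head = last line); each line is justified by the lines before it.
data Derivation (H : List Seq) (E : ExtSys) : List Seq → Set where
  []  : Derivation H E []
  _∷_ : ∀ {S ls} → GoodSeq E S × Justified H E ls S →
        Derivation H E ls → Derivation H E (S ∷ ls)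

DerivationOf : List Seq → ExtSys → Seq → List Seq → Set
DerivationOf H E S ls = Derivation H E ls × (Σ (List Seq) λ rest → ls ≡ S ∷ rest)

-- Size = number of symbols

size : Fm → ℕ
size (var p)   = 1
size (ext i)   = 1
size 𝟘         = 1
size 𝟙         = 1
size (A ∨f B)  = 1 + size A + size B
size (dec A p B) = 2 + size A + size B   -- symbols: dec, p

sizeL : List Fm → ℕ
sizeL Γ = sum (map size Γ)

sizeSeq : Seq → ℕ
sizeSeq (Γ , Δ) = 1 + sizeL Γ + sizeL Δ   -- the arrow counts 1

sizeDer : List Seq → ℕ
sizeDer ls = sum (map sizeSeq ls)

sizeSys : ExtSys → ℕ
sizeSys E = sum (map (λ A → 2 + size A) E)

AllGood : ExtSys → List Fm → Set
AllGood E Γ = All (λ F → Positive F × Below (length E) F) Γ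

-- Read bottom-up, positive decision left splits the endsequent into Γ, A → Δ, pd(A',p,B') and
-- Γ, p, B → Δ, pd(A',p,B'), and positive decision right splits each of these once more. The four
-- resulting sequents are weakenings of the two hypotheses and of p → p, the latter weakened one
-- formula at a time by Γ and Δ. The tree has 13 + |Γ| + |Δ| sequents, and every premise consists of
-- formulas of its conclusion and constituents of their positive decisions, so no sequent is larger
-- than the endsequent S; listing the tree gives a derivation of size at most (13 + |S|) · |S|.
module Submission where

open import Defs
open import Data.Nat using (ℕ; suc; _+_; _*_; _^_; _≤_; z≤n; s≤s)
open import Data.Nat.Properties
  using (≤-trans; ≤-reflexive; +-mono-≤; +-monoˡ-≤; +-monoʳ-≤; *-mono-≤; *-monoˡ-≤; *-monoʳ-≤;
         m≤m+n; m≤n+m; +-comm; *-assoc; *-identityʳ; *-distribʳ-+; module ≤-Reasoning)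
open import Data.Nat.ListAction using (sum)
open import Data.Nat.ListAction.Properties using (sum-++; sum-↭)
open import Data.Nat.Tactic.RingSolver using (solve-∀)
open import Data.List using (List; []; _∷_; _++_; [_]; length; map)
open import Data.List.Properties using (++-assoc; map-++)
open import Data.List.Relation.Unary.All using (All; []; _∷_)
import Data.List.Relation.Unary.All as All
import Data.List.Relation.Unary.All.Properties as All
open import Data.List.Relation.Unary.Any using (Any; here; there)
import Data.List.Relation.Unary.Any.Properties as Any
open import Data.List.Relation.Binary.Permutation.Propositional
  using (_↭_; ↭-refl; ↭-sym; ↭-trans; ↭-reflexive; swap)
import Data.List.Relation.Binary.Permutation.Propositional.Properties as ↭
open import Data.List.Relation.Binary.Sublist.Propositional using (_⊆_; []; _∷_; _∷ʳ_)
open import Data.List.Relation.Binary.Sublist.Propositional.Properties using (All-resp-⊆)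
open import Data.Product using (_×_; _,_; Σ; proj₁; proj₂)
open import Relation.Binary.PropositionalEquality
  using (_≡_; refl; sym; trans; cong; module ≡-Reasoning)

Good : ℕ → Fm → Set
Good n F = Positive F × Below n F

pd-good : ∀ {n A B} p → Good n A → Good n B → Good n (pd A p B)
pd-good p (pA , bA) (pB , bB) = pos-pd p pA pB , b-dec p bA (b-∨ bA bB)

pd-good⁻ : ∀ {n A B p} → Good n (pd A p B) → Good n A × Good n B
pd-good⁻ (pos-pd p pA pB , b-dec .p bA (b-∨ _ bB)) = (pA , bA) , (pB , bB)

sizeL-++ : ∀ xs ys → sizeL (xs ++ ys) ≡ sizeL xs + sizeL ys
sizeL-++ xs ys = trans (cong sum (map-++ size xs ys)) (sum-++ (map size xs) (map size ys))

sizeL-↭ : ∀ {xs ys} → xs ↭ ys → sizeL xs ≡ sizeL ys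
sizeL-↭ xs↭ys = sum-↭ (↭.map⁺ size xs↭ys)

sizeL-mono-⊆ : ∀ {xs ys} → xs ⊆ ys → sizeL xs ≤ sizeL ys
sizeL-mono-⊆ []             = z≤n
sizeL-mono-⊆ (y ∷ʳ xs⊆ys)   = ≤-trans (sizeL-mono-⊆ xs⊆ys) (m≤n+m _ (size y))
sizeL-mono-⊆ (refl ∷ xs⊆ys) = +-monoʳ-≤ _ (sizeL-mono-⊆ xs⊆ys)

length≤sizeL : ∀ xs → length xs ≤ sizeL xs
length≤sizeL []       = z≤n
length≤sizeL (x ∷ xs) = +-mono-≤ (size≥1 x) (length≤sizeL xs)
  where
  size≥1 : ∀ F → 1 ≤ size F
  size≥1 (var _)     = s≤s z≤n
  size≥1 (ext _)     = s≤s z≤n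
  size≥1 𝟘           = s≤s z≤n
  size≥1 𝟙           = s≤s z≤n
  size≥1 (_ ∨f _)    = s≤s z≤n
  size≥1 (dec _ _ _) = s≤s z≤n

lengths≤sizeSeq : ∀ Γ Δ → length Γ + length Δ ≤ sizeSeq (Γ , Δ)
lengths≤sizeSeq Γ Δ = +-mono-≤ (≤-trans (length≤sizeL Γ) (m≤n+m _ 1)) (length≤sizeL Δ)

infix 4 _⊑_
_⊑_ : List Fm → List Fm → Set
xs ⊑ ys = (∀ {n} → All (Good n) ys → All (Good n) xs) × sizeL xs ≤ sizeL ys

⊑-trans : ∀ {xs ys zs} → xs ⊑ ys → ys ⊑ zs → xs ⊑ zs
⊑-trans (good₁ , size₁) (good₂ , size₂) = (λ g → good₁ (good₂ g)) , ≤-trans size₁ size₂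

↭⇒⊑ : ∀ {xs ys} → xs ↭ ys → xs ⊑ ys
↭⇒⊑ xs↭ys = ↭.All-resp-↭ (↭-sym xs↭ys) , ≤-reflexive (sizeL-↭ xs↭ys)

⊑-refl : ∀ {xs} → xs ⊑ xs
⊑-refl = ↭⇒⊑ ↭-refl

⊆⇒⊑ : ∀ {xs ys} → xs ⊆ ys → xs ⊑ ys
⊆⇒⊑ xs⊆ys = All-resp-⊆ xs⊆ys , sizeL-mono-⊆ xs⊆ys

⊑-++ : ∀ {xs ys us vs} → xs ⊑ ys → us ⊑ vs → xs ++ us ⊑ ys ++ vs
⊑-++ {xs} {ys} {us} {vs} (good₁ , size₁) (good₂ , size₂) =
  (λ g → All.++⁺ (good₁ (All.++⁻ˡ ys g)) (good₂ (All.++⁻ʳ ys g))) ,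
  (begin
    sizeL (xs ++ us)    ≡⟨ sizeL-++ xs us ⟩
    sizeL xs + sizeL us ≤⟨ +-mono-≤ size₁ size₂ ⟩
    sizeL ys + sizeL vs ≡⟨ sizeL-++ ys vs ⟨
    sizeL (ys ++ vs)    ∎)
  where open ≤-Reasoning

⊑-++ʳ : ∀ xs {ys} → xs ⊑ xs ++ ys
⊑-++ʳ xs {ys} = All.++⁻ˡ xs , ≤-trans (m≤m+n _ _) (≤-reflexive (sym (sizeL-++ xs ys)))

constituents⊑pd : ∀ {xs} A p B → xs ⊆ A ∷ var p ∷ B ∷ [] → xs ⊑ [ pd A p B ]
constituents⊑pd A p B xs⊆ = ⊑-trans (⊆⇒⊑ xs⊆) (good , size-bound)
  where
  good : ∀ {n} → All (Good n) [ pd A p B ] → All (Good n) (A ∷ var p ∷ B ∷ [])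
  good (g ∷ []) = proj₁ (pd-good⁻ g) ∷ (pos-var p , b-var p) ∷ proj₂ (pd-good⁻ g) ∷ []
  excess : ∀ a b → a + (1 + (b + 0)) + (a + 2) ≡ 2 + a + (1 + a + b) + 0
  excess = solve-∀
  size-bound : sizeL (A ∷ var p ∷ B ∷ []) ≤ sizeL [ pd A p B ]
  size-bound = ≤-trans (m≤m+n _ (size A + 2)) (≤-reflexive (excess (size A) (size B)))

≈S-refl : ∀ {S} → S ≈S S
≈S-refl {Γ , Δ} = ↭-refl , ↭-refl

≈S-sym : ∀ {S T} → S ≈S T → T ≈S S
≈S-sym {Γ , Δ} {Γ' , Δ'} (Γ↭ , Δ↭) = ↭-sym Γ↭ , ↭-sym Δ↭

infix 4 _≼_
_≼_ : Seq → Seq → Set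
(Γ , Δ) ≼ (Γ' , Δ') = Γ ⊑ Γ' × Δ ⊑ Δ'

≼-trans : ∀ {S T U} → S ≼ T → T ≼ U → S ≼ U
≼-trans {_ , _} {_ , _} {_ , _} (Γ⊑ , Δ⊑) (Γ⊑' , Δ⊑') = ⊑-trans Γ⊑ Γ⊑' , ⊑-trans Δ⊑ Δ⊑'

≈S⇒≼ : ∀ {S T} → S ≈S T → S ≼ T
≈S⇒≼ {_ , _} {_ , _} (Γ↭ , Δ↭) = ↭⇒⊑ Γ↭ , ↭⇒⊑ Δ↭

≼-goodSeq : ∀ {E S T} → S ≼ T → GoodSeq E T → GoodSeq E S
≼-goodSeq {S = Γ , Δ} {Γ' , Δ'} (Γ⊑ , Δ⊑) g =
  All.++⁺ (proj₁ Γ⊑ (All.++⁻ˡ Γ' g)) (proj₁ Δ⊑ (All.++⁻ʳ Γ' g))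

≼-sizeSeq : ∀ {S T} → S ≼ T → sizeSeq S ≤ sizeSeq T
≼-sizeSeq {_ , _} {_ , _} (Γ⊑ , Δ⊑) = +-mono-≤ (+-monoʳ-≤ 1 (proj₂ Γ⊑)) (proj₂ Δ⊑)

justified-++ : ∀ {H E es S} es' → Justified H E es S → Justified H E (es ++ es') S
justified-++ es' (by-hyp h)            = by-hyp h
justified-++ es' (by-ext ax eq)        = by-ext ax eq
justified-++ es' (by-init i eq)        = by-init i eq
justified-++ es' (by-rule r eq prems)  = by-rule r eq (All.map Any.++⁺ˡ prems)

infixr 5 _++ᴰ_
_++ᴰ_ : ∀ {H E ls ls'} → Derivation H E ls → Derivation H E ls' → Derivation H E (ls ++ ls')
[]            ++ᴰ D' = D'
((g , j) ∷ D) ++ᴰ D' = (g , justified-++ _ j) ∷ (D ++ᴰ D')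

sizeDer-++ : ∀ ls ls' → sizeDer (ls ++ ls') ≡ sizeDer ls + sizeDer ls'
sizeDer-++ ls ls' = trans (cong sum (map-++ sizeSeq ls ls')) (sum-++ (map sizeSeq ls) (map sizeSeq ls'))

-- Premises must be ≼ their conclusions (which excludes cut and contraction), so every line
-- inherits goodness and the size bound from the endsequent.
data Tree (H : List Seq) : Seq → Set where
  hyp    : ∀ {S} → Any (S ≈S_) H → Tree H S
  axiom  : ∀ {S T} → Initial T → S ≈S T → Tree H S
  unary  : ∀ {S T P} → Rule (P ∷ []) T → S ≈S T → P ≼ S → Tree H P → Tree H S
  binary : ∀ {S T P Q} → Rule (P ∷ Q ∷ []) T → S ≈S T → P ≼ S → Q ≼ S →
           Tree H P → Tree H Q → Tree H S

module _ {H : List Seq} where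

  nodes : ∀ {S} → Tree H S → ℕ
  nodes (hyp _)              = 1
  nodes (axiom _ _)          = 1
  nodes (unary _ _ _ t)      = suc (nodes t)
  nodes (binary _ _ _ _ t u) = suc (nodes t + nodes u)

  mutual
    lines : ∀ {S} → Tree H S → List Seq
    lines {S} t = S ∷ linesAbove t

    linesAbove : ∀ {S} → Tree H S → List Seq
    linesAbove (hyp _)              = []
    linesAbove (axiom _ _)          = []
    linesAbove (unary _ _ _ t)      = lines t
    linesAbove (binary _ _ _ _ t u) = lines t ++ lines u

  lines-derivation : ∀ {E S} (t : Tree H S) → GoodSeq E S → Derivation H E (lines t)
  lines-derivation (hyp h) g      = (g , by-hyp h) ∷ []
  lines-derivation (axiom i eq) g = (g , by-init i eq) ∷ []
  lines-derivation {E} (unary r eq P≼S t) g =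
    (g , by-rule r eq (here ≈S-refl ∷ [])) ∷ lines-derivation t (≼-goodSeq {E} P≼S g)
  lines-derivation {E} (binary r eq P≼S Q≼S t u) g =
    (g , by-rule r eq (here ≈S-refl ∷ Any.++⁺ʳ (lines t) (here ≈S-refl) ∷ [])) ∷
    (lines-derivation t (≼-goodSeq {E} P≼S g) ++ᴰ lines-derivation u (≼-goodSeq {E} Q≼S g))

  lines-size : ∀ {S M} (t : Tree H S) → sizeSeq S ≤ M → sizeDer (lines t) ≤ nodes t * M
  lines-size (hyp _) S≤M     = +-monoˡ-≤ 0 S≤M
  lines-size (axiom _ _) S≤M = +-monoˡ-≤ 0 S≤M
  lines-size (unary _ _ P≼S t) S≤M =
    +-mono-≤ S≤M (lines-size t (≤-trans (≼-sizeSeq P≼S) S≤M))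
  lines-size {M = M} (binary _ _ P≼S Q≼S t u) S≤M = +-mono-≤ S≤M (begin
    sizeDer (lines t ++ lines u)          ≡⟨ sizeDer-++ (lines t) (lines u) ⟩
    sizeDer (lines t) + sizeDer (lines u) ≤⟨ +-mono-≤ (lines-size t (≤-trans (≼-sizeSeq P≼S) S≤M))
                                                      (lines-size u (≤-trans (≼-sizeSeq Q≼S) S≤M)) ⟩
    nodes t * M + nodes u * M             ≡⟨ *-distribʳ-+ M (nodes t) (nodes u) ⟨
    (nodes t + nodes u) * M               ∎)
    where open ≤-Reasoning

  tree⇒derivation : ∀ {E S} (t : Tree H S) → GoodSeq E S →
                    Σ (List Seq) λ D → DerivationOf H E S D × sizeDer D ≤ nodes t * sizeSeq S
  tree⇒derivation t g = lines t , (lines-derivation t g , linesAbove t , refl) , lines-size t (≤-reflexive refl)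

  wkˡ : ∀ {S} Γ Δ A → S ≈S (Γ ++ [ A ] , Δ) → Tree H (Γ , Δ) → Tree H S
  wkˡ Γ Δ A eq = unary (wk-l Γ Δ A) eq (≼-trans (⊑-++ʳ Γ , ⊑-refl) (≈S⇒≼ (≈S-sym eq)))

  wkʳ : ∀ {S} Γ Δ A → S ≈S (Γ , Δ ++ [ A ]) → Tree H (Γ , Δ) → Tree H S
  wkʳ Γ Δ A eq = unary (wk-r Γ Δ A) eq (≼-trans (⊑-refl , ⊑-++ʳ Δ) (≈S⇒≼ (≈S-sym eq)))

  pdˡ : ∀ {S} Γ Δ A p B → S ≈S (Γ ++ [ pd A p B ] , Δ) →
        Tree H (Γ ++ [ A ] , Δ) → Tree H (Γ ++ var p ∷ B ∷ [] , Δ) → Tree H S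
  pdˡ Γ Δ A p B eq = binary (pd-l Γ Δ A p B) eq (premise (refl ∷ var p ∷ʳ B ∷ʳ []))
                                                (premise (A ∷ʳ refl ∷ refl ∷ []))
    where
    premise : ∀ {xs} → xs ⊆ A ∷ var p ∷ B ∷ [] → (Γ ++ xs , Δ) ≼ _
    premise xs⊆ = ≼-trans (⊑-++ ⊑-refl (constituents⊑pd A p B xs⊆) , ⊑-refl) (≈S⇒≼ (≈S-sym eq))

  pdʳ : ∀ {S} Γ Δ A p B → S ≈S (Γ , Δ ++ [ pd A p B ]) →
        Tree H (Γ , Δ ++ A ∷ var p ∷ []) → Tree H (Γ , Δ ++ A ∷ B ∷ []) → Tree H S
  pdʳ Γ Δ A p B eq = binary (pd-r Γ Δ A p B) eq (premise (refl ∷ refl ∷ B ∷ʳ []))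
                                                (premise (refl ∷ var p ∷ʳ refl ∷ []))
    where
    premise : ∀ {xs} → xs ⊆ A ∷ var p ∷ B ∷ [] → (Γ , Δ ++ xs) ≼ _
    premise xs⊆ = ≼-trans (⊑-refl , ⊑-++ ⊑-refl (constituents⊑pd A p B xs⊆)) (≈S⇒≼ (≈S-sym eq))

  weakenˡ* : ∀ {Γ Δ} X → Tree H (Γ , Δ) → Tree H (X ++ Γ , Δ)
  weakenˡ*         []      t = t
  weakenˡ* {Γ} {Δ} (x ∷ X) t = wkˡ (X ++ Γ) Δ x (↭.∷↭∷ʳ x (X ++ Γ) , ↭-refl) (weakenˡ* X t)

  weakenʳ* : ∀ {Γ Δ} X → Tree H (Γ , Δ) → Tree H (Γ , X ++ Δ)
  weakenʳ*         []      t = t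
  weakenʳ* {Γ} {Δ} (x ∷ X) t = wkʳ Γ (X ++ Δ) x (↭-refl , ↭.∷↭∷ʳ x (X ++ Δ)) (weakenʳ* X t)

  nodes-weakenˡ* : ∀ {Γ Δ} X (t : Tree H (Γ , Δ)) → nodes (weakenˡ* X t) ≡ length X + nodes t
  nodes-weakenˡ* []      t = refl
  nodes-weakenˡ* (x ∷ X) t = cong suc (nodes-weakenˡ* X t)

  nodes-weakenʳ* : ∀ {Γ Δ} X (t : Tree H (Γ , Δ)) → nodes (weakenʳ* X t) ≡ length X + nodes t
  nodes-weakenʳ* []      t = refl
  nodes-weakenʳ* (x ∷ X) t = cong suc (nodes-weakenʳ* X t)

snoc-snoc : ∀ xs {x y : Fm} → xs ++ x ∷ y ∷ [] ↭ (xs ++ [ x ]) ++ [ y ]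
snoc-snoc xs {x} {y} = ↭-reflexive (sym (++-assoc xs [ x ] [ y ]))

snoc-snoc-swap : ∀ xs {x y : Fm} → xs ++ x ∷ y ∷ [] ↭ (xs ++ [ y ]) ++ [ x ]
snoc-snoc-swap xs {x} {y} = ↭-trans (↭.++⁺ˡ xs (swap x y ↭-refl)) (snoc-snoc xs)

square-bound : ∀ c {m N} → m ≤ N → (c + m) * m ≤ suc c * (N + 1) ^ 2
square-bound c {m} {N} m≤N = begin
  (c + m) * m                   ≤⟨ *-mono-≤ c+m≤ m≤N+1 ⟩
  suc c * (N + 1) * (N + 1)     ≡⟨ *-assoc (suc c) (N + 1) (N + 1) ⟩
  suc c * ((N + 1) * (N + 1))   ≡⟨ cong (λ k → suc c * ((N + 1) * k)) (*-identityʳ (N + 1)) ⟨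
  suc c * (N + 1) ^ 2           ∎
  where
  open ≤-Reasoning
  m≤N+1 : m ≤ N + 1
  m≤N+1 = ≤-trans m≤N (m≤m+n N 1)
  c+m≤ : c + m ≤ suc c * (N + 1)
  c+m≤ = begin
    c + m                 ≡⟨ +-comm c m ⟩
    m + c                 ≤⟨ +-mono-≤ m≤N+1 (≤-trans (≤-reflexive (sym (*-identityʳ c))) (*-monoʳ-≤ c (m≤n+m 1 N))) ⟩
    (N + 1) + c * (N + 1) ∎

module _ (Γ Δ : List Fm) (A B A' B' : Fm) (p : ℕ) where

  hypotheses : List Seq
  hypotheses = (Γ ++ [ A ] , Δ ++ [ A' ]) ∷ (Γ ++ [ B ] , Δ ++ [ B' ]) ∷ []

  p-weakenedˡ : Tree hypotheses (Γ ++ [ var p ] , [ var p ])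
  p-weakenedˡ = weakenˡ* Γ (axiom (init-p p) ≈S-refl)

  endsequent : Seq
  endsequent = (Γ ++ [ pd A p B ] , Δ ++ [ pd A' p B' ])

  pd-tree : Tree hypotheses endsequent
  pd-tree = pdˡ Γ (Δ ++ [ pd A' p B' ]) A p B ≈S-refl
    (pdʳ (Γ ++ [ A ]) Δ A' p B' ≈S-refl
      (wkʳ (Γ ++ [ A ]) (Δ ++ [ A' ]) (var p) (↭-refl , snoc-snoc Δ) (hyp (here ≈S-refl)))
      (wkʳ (Γ ++ [ A ]) (Δ ++ [ A' ]) B' (↭-refl , snoc-snoc Δ) (hyp (here ≈S-refl))))
    (pdʳ (Γ ++ var p ∷ B ∷ []) Δ A' p B' ≈S-refl
      (wkʳ (Γ ++ var p ∷ B ∷ []) (Δ ++ [ var p ]) A' (↭-refl , snoc-snoc-swap Δ)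
        (wkˡ (Γ ++ [ var p ]) (Δ ++ [ var p ]) B (snoc-snoc Γ , ↭-refl) (weakenʳ* Δ p-weakenedˡ)))
      (wkˡ (Γ ++ [ B ]) (Δ ++ A' ∷ B' ∷ []) (var p) (snoc-snoc-swap Γ , ↭-refl)
        (wkʳ (Γ ++ [ B ]) (Δ ++ [ B' ]) A' (↭-refl , snoc-snoc-swap Δ) (hyp (there (here ≈S-refl))))))

  pd-tree-nodes : nodes pd-tree ≡ 13 + (length Γ + length Δ)
  pd-tree-nodes = begin
    nodes pd-tree                                   ≡⟨⟩
    9 + (nodes (weakenʳ* Δ p-weakenedˡ) + 3)        ≡⟨ cong (λ n → 9 + (n + 3)) (nodes-weakenʳ* Δ p-weakenedˡ) ⟩
    9 + (length Δ + nodes p-weakenedˡ + 3)          ≡⟨ cong (λ n → 9 + (length Δ + n + 3)) (nodes-weakenˡ* Γ _) ⟩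
    9 + (length Δ + (length Γ + 1) + 3)             ≡⟨ count (length Γ) (length Δ) ⟩
    13 + (length Γ + length Δ)                      ∎
    where
    open ≡-Reasoning
    count : ∀ m n → 9 + (n + (m + 1) + 3) ≡ 13 + (m + n)
    count = solve-∀

  pd-derivable : ∀ {E} → AllGood E Γ → AllGood E Δ → AllGood E (A ∷ B ∷ A' ∷ B' ∷ []) →
    Σ (List Seq) λ D → DerivationOf hypotheses E endsequent D
                       × sizeDer D ≤ (13 + sizeSeq endsequent) * sizeSeq endsequent
  pd-derivable {E} gΓ gΔ (gA ∷ gB ∷ gA' ∷ gB' ∷ []) =
    let (D , D-derives , D-size) = tree⇒derivation pd-tree endsequent-good
    in D , D-derives , ≤-trans D-size (*-monoˡ-≤ (sizeSeq endsequent) nodes≤)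
    where
    nodes≤ : nodes pd-tree ≤ 13 + sizeSeq endsequent
    nodes≤ = begin
      nodes pd-tree               ≡⟨ pd-tree-nodes ⟩
      13 + (length Γ + length Δ)  ≤⟨ +-monoʳ-≤ 13 (lengths≤sizeSeq Γ Δ) ⟩
      13 + sizeSeq (Γ , Δ)        ≤⟨ +-monoʳ-≤ 13 (≼-sizeSeq {Γ , Δ} {endsequent} (⊑-++ʳ Γ , ⊑-++ʳ Δ)) ⟩
      13 + sizeSeq endsequent     ∎
      where open ≤-Reasoning
    endsequent-good : GoodSeq E endsequent
    endsequent-good = All.++⁺ (All.++⁺ gΓ (pd-good p gA gB ∷ [])) (All.++⁺ gΔ (pd-good p gA' gB' ∷ []))

mainTheorem16 : Σ ℕ λ c → Σ ℕ λ k →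
    (E : ExtSys) → WellFounded E → PositiveSys E →
    (Γ Δ : List Fm) → (A B A' B' : Fm) → (p : ℕ) →
    AllGood E Γ → AllGood E Δ → AllGood E (A ∷ B ∷ A' ∷ B' ∷ []) →
    let H₁ = (Γ ++ [ A ] , Δ ++ [ A' ])
        H₂ = (Γ ++ [ B ] , Δ ++ [ B' ])
        S  = (Γ ++ [ pd A p B ] , Δ ++ [ pd A' p B' ])
        N  = sizeSeq H₁ + sizeSeq H₂ + sizeSeq S + sizeSys E
    in Σ (List Seq) λ D →
         DerivationOf (H₁ ∷ H₂ ∷ []) E S D × (sizeDer D ≤ c * (N + 1) ^ k)
mainTheorem16 = 14 , 2 , λ E _ _ Γ Δ A B A' B' p gΓ gΔ gFs →
  let (D , D-derives , D-size) = pd-derivable Γ Δ A B A' B' p gΓ gΔ gFs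
      H₁ = (Γ ++ [ A ] , Δ ++ [ A' ])
      H₂ = (Γ ++ [ B ] , Δ ++ [ B' ])
      S  = endsequent Γ Δ A B A' B' p
      S≤N : sizeSeq S ≤ sizeSeq H₁ + sizeSeq H₂ + sizeSeq S + sizeSys E
      S≤N = ≤-trans (m≤n+m (sizeSeq S) (sizeSeq H₁ + sizeSeq H₂)) (m≤m+n _ (sizeSys E))
  in D , D-derives , ≤-trans D-size (square-bound 13 S≤N)
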